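{- Let $P=v_1\cdots v_n$ be a path with $n$ odd, let $L$ be a list assignment on $P$ with $|L(v_i)|=4$ for all $i$, and let $W$ be any set of $4$ colours. Then $P$ has at most $2$ bad $W$-sets.
   Context: $X_1=L(v_1)$, $X_i=L(v_i)\setminus X_{i-1}$ ($i>1$), $S_L(P)=\sum_i|X_i|$. For colour sets $p,q$, $L^{p,q}$ is $L$ with colours of $p$ deleted from $L(v_1)$ and of $q$ deleted from $L(v_n)$ (both from $L(v_1)$ if $n=1$), and $\mathrm{dam}(p,q)=S_L(P)-S_{L^{p,q}}(P)$. A bad $W$-set for $P$ is a $2$-element set $p\subset W$ with $\mathrm{dam}(p,p)>S_L(P)-2|V(P)|$. -}

module Defs where

open import Data.Nat using (ℕ; zero; suc; _+_; _*_; _≟_)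
open import Data.Integer as ℤ using (ℤ; +_; _-_; _<_)
open import Data.Fin using (Fin; toℕ)
open import Data.List using (List; []; _∷_; length; filter; tabulate)
open import Data.List.Membership.DecPropositional _≟_ using (_∈?_)
open import Relation.Nullary using (¬?; yes; no)

-- Colours are natural numbers; a colour set is a duplicate-free list of colours.
Colours : Set
Colours = List ℕ

_∖_ : Colours → Colours → Colours
A ∖ B = filter (λ x → ¬? (x ∈? B)) A

-- A list assignment on the path v_1 ⋯ v_n (vertex v_{i+1} ↦ index i : Fin n).
ListAssignment : ℕ → Set
ListAssignment n = Fin n → Colours

-- Given X_{i-1} and the remaining lists L(v_i), L(v_{i+1}), …,
-- compute Σ_{j ≥ i} |X_j| where X_j = L(v_j) \ X_{j-1}.
S-from : Colours → List Colours → ℕ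
S-from prev [] = 0
S-from prev (B ∷ rest) = length (B ∖ prev) + S-from (B ∖ prev) rest

S-list : List Colours → ℕ
S-list [] = 0
S-list (A ∷ rest) = length A + S-from A rest

S : (n : ℕ) → ListAssignment n → ℕ
S n L = S-list (tabulate L)

-- L^{p,q}: delete p from L(v_1) and q from L(v_n) (both from L(v_1) when n = 1).
delFirst : {n : ℕ} → Fin n → Colours → Colours → Colours
delFirst i p A with toℕ i ≟ 0
... | yes _ = A ∖ p
... | no _ = A

delLast : (n : ℕ) → Fin n → Colours → Colours → Colours
delLast n i q A with suc (toℕ i) ≟ n
... | yes _ = A ∖ q
... | no _ = A

modify : (n : ℕ) → ListAssignment n → Colours → Colours → ListAssignment n
modify n L p q i = delLast n i q (delFirst i p (L i))

dam : (n : ℕ) → ListAssignment n → Colours → Colours → ℤ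
dam n L p q = + S n L - + S n (modify n L p q)

-- the two-element set {a , b} (a < b) is a bad W-set for P
-- (membership in W and a < b are imposed separately)
IsBadPair : (n : ℕ) → ListAssignment n → ℕ → ℕ → Set
IsBadPair n L a b = (+ S n L - + (2 * n)) ℤ.< dam n L (a ∷ b ∷ []) (a ∷ b ∷ [])

-- For a colour c, write N(c) for the number of i with c ∈ X_i, so that S_L(P) = Σ_c N(c).
-- Along a run of consecutive lists containing c, the colour enters X at every other vertex,
-- starting with the first; hence N(c) is at least the number of odd-indexed lists containing c
-- and at least the number E(c) of even-indexed ones. As n = 2k + 1, the odd-indexed lists
-- contribute 4k + 4 and the even-indexed ones 4k, so the excess e(c) = N(c) − E(c) has Σ_c e(c) ≥ 4.
-- Deleting p from L(v_1) and L(v_n) only touches odd indices: afterwards N(c) is still at least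
-- E(c), it dropped by at most 2 if c ∈ p, and not at all otherwise. A bad set p = {a, b} means
-- S_{L^{p,p}}(P) < 2n = 4k + 2, which forces (e(a) − 2)⁺ + (e(b) − 2)⁺ + Σ_{c ∉ p} e(c) ≤ 1.
-- Together with Σ_c e(c) ≥ 4: e(a), e(b) ≥ 1, one of them is ≥ 2, and e has mass ≤ 1 outside p.
-- Then a colour h with e(h) ≥ 2 lies in every bad set, and three bad sets {h, y₁}, {h, y₂},
-- {h, y₃} are impossible: y₂ and y₃ would be two colours outside {h, y₁} with e ≥ 1.

module Submission where

open import Defs
open import Data.Nat using (ℕ; zero; suc; _+_; _*_; _∸_; _⊓_; _⊔_; _≤_; _<_; _%_; _/_; z≤n; s≤s; _≟_)
open import Data.Nat.Properties
open import Data.Nat.DivMod using (m≡m%n+[m/n]*n)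
open import Data.Nat.Tactic.RingSolver using (solve-∀)
open import Algebra.Properties.CommutativeSemigroup +-commutativeSemigroup using (interchange)
open import Data.Bool using (Bool; true; false; T; _∧_; not; if_then_else_)
open import Data.Bool.Properties using (∧-identityʳ)
open import Data.Empty using (⊥; ⊥-elim)
open import Data.Unit using (tt)
open import Data.Fin using (Fin; toℕ) renaming (zero to fzero; suc to fsuc)
import Data.Integer as ℤ
import Data.Integer.Properties as ℤₚ
open import Data.List using (List; []; _∷_; length; map; tabulate; concat)
open import Data.List.Extrema.Nat using (max; xs≤max)
open import Data.List.Membership.DecPropositional _≟_ using (_∈_; _∉_; _∈?_)
open import Data.List.Membership.Propositional.Properties using (∈-filter⁺; ∈-filter⁻; ∈-concat⁺′; ∈-tabulate⁺)
open import Data.List.Properties using (tabulate-cong; map-tabulate)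
open import Data.List.Relation.Unary.All as All using (All; []; _∷_)
import Data.List.Relation.Unary.All.Properties as All
open import Data.List.Relation.Unary.AllPairs using (_∷_)
open import Data.List.Relation.Unary.Any using (here; there)
open import Data.List.Relation.Unary.Unique.Propositional using (Unique)
import Data.List.Relation.Unary.Unique.Propositional.Properties as Unique
open import Data.Product using (_×_; _,_; proj₁; proj₂; ∃-syntax)
open import Data.Sum using (_⊎_; inj₁; inj₂)
open import Function using (_∘_)
open import Relation.Nullary using (¬_; Dec; yes; no; does; ¬?; contradiction)
open import Relation.Nullary.Decidable using (dec-true; dec-false)
open import Relation.Binary.PropositionalEquality

𝟙 : Bool → ℕ
𝟙 b = if b then 1 else 0

mem : ℕ → Colours → Bool
mem c A = does (c ∈? A)

-- countX [c ∈ X_{i-1}] ([c ∈ L(v_i)] ∷ [c ∈ L(v_{i+1})] ∷ …) = #{j ≥ i : c ∈ X_j}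
countX : Bool → List Bool → ℕ
countX _ [] = 0
countX true (_ ∷ bs) = countX false bs
countX false (false ∷ bs) = countX false bs
countX false (true ∷ bs) = suc (countX true bs)

countX-∷ : ∀ inX b bs → countX inX (b ∷ bs) ≡ 𝟙 (b ∧ not inX) + countX (b ∧ not inX) bs
countX-∷ true false bs = refl
countX-∷ true true bs = refl
countX-∷ false false bs = refl
countX-∷ false true bs = refl

countX-true≤false : ∀ bs → countX true bs ≤ countX false bs
countX-false≤1+true : ∀ bs → countX false bs ≤ suc (countX true bs)
countX-true≤false [] = z≤n
countX-true≤false (true ∷ bs) = countX-false≤1+true bs
countX-true≤false (false ∷ bs) = ≤-refl
countX-false≤1+true [] = z≤n
countX-false≤1+true (true ∷ bs) = s≤s (countX-true≤false bs)
countX-false≤1+true (false ∷ bs) = n≤1+n _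

countX-head : ∀ inX x y bs → countX inX (x ∷ bs) ≤ suc (countX inX (y ∷ bs))
countX-head true _ _ bs = n≤1+n _
countX-head false false false bs = n≤1+n _
countX-head false true true bs = n≤1+n _
countX-head false true false bs = s≤s (countX-true≤false bs)
countX-head false false true bs = ≤-trans (countX-false≤1+true bs) (n≤1+n _)

countX-∷-mono : ∀ inX x {bs cs} → (∀ inX′ → countX inX′ bs ≤ suc (countX inX′ cs)) →
  countX inX (x ∷ bs) ≤ suc (countX inX (x ∷ cs))
countX-∷-mono true _ bs≤cs = bs≤cs false
countX-∷-mono false false bs≤cs = bs≤cs false
countX-∷-mono false true bs≤cs = s≤s (bs≤cs true)

countX-agreeExcept : ∀ {n} m (f g : Fin n → Bool) → (∀ i → toℕ i ≢ m → f i ≡ g i) →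
  ∀ inX → countX inX (tabulate f) ≤ suc (countX inX (tabulate g))
countX-agreeExcept {zero} m f g f≈g inX = z≤n
countX-agreeExcept {suc n} zero f g f≈g inX =
  subst (λ bs → countX inX (f fzero ∷ tabulate (f ∘ fsuc)) ≤ suc (countX inX (g fzero ∷ bs)))
    (tabulate-cong (λ i → f≈g (fsuc i) λ ()))
    (countX-head inX (f fzero) (g fzero) _)
countX-agreeExcept {suc n} (suc m) f g f≈g inX rewrite f≈g fzero (λ ()) =
  countX-∷-mono inX (g fzero)
    (countX-agreeExcept m (f ∘ fsuc) (g ∘ fsuc) (λ i i≢m → f≈g (fsuc i) (i≢m ∘ suc-injective)))

altSum : Bool → List ℕ → ℕ
altSum _ [] = 0
altSum true (x ∷ xs) = x + altSum false xs
altSum false (_ ∷ xs) = altSum true xs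

-- A run of consecutive lists containing c enters X at its 1st, 3rd, 5th, … list, which is at
-- least as often as it meets positions of either parity.
altSum≤countX : ∀ t bs → altSum t (map 𝟙 bs) ≤ countX false bs
altSum≤countX t bs = proj₁ (bounds t bs)
  where
  bounds : ∀ t bs → altSum t (map 𝟙 bs) ≤ countX false bs × altSum t (map 𝟙 bs) ≤ 𝟙 t + countX true bs
  bounds t [] = z≤n , z≤n
  bounds true (true ∷ bs) = s≤s (proj₂ (bounds false bs)) , s≤s (proj₁ (bounds false bs))
  bounds true (false ∷ bs) = proj₁ (bounds false bs) , ≤-trans (proj₁ (bounds false bs)) (n≤1+n _)
  bounds false (true ∷ bs) = proj₂ (bounds true bs) , proj₁ (bounds true bs)
  bounds false (false ∷ bs) = proj₁ (bounds true bs) , proj₁ (bounds true bs)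

Counted : Bool → ℕ → Set
Counted t zero = T t
Counted t (suc m) = Counted (not t) m

altSum-agree : ∀ {n} t (f g : Fin n → ℕ) → (∀ i → Counted t (toℕ i) → f i ≡ g i) →
  altSum t (tabulate f) ≡ altSum t (tabulate g)
altSum-agree {zero} t f g f≈g = refl
altSum-agree {suc n} true f g f≈g =
  cong₂ _+_ (f≈g fzero tt) (altSum-agree false (f ∘ fsuc) (g ∘ fsuc) (f≈g ∘ fsuc))
altSum-agree {suc n} false f g f≈g = altSum-agree true (f ∘ fsuc) (g ∘ fsuc) (f≈g ∘ fsuc)

even-not-counted : ∀ k → ¬ Counted false (k * 2)
even-not-counted zero ()
even-not-counted (suc k) = even-not-counted k

altSum-const : ∀ k v → altSum true (tabulate {n = suc (k * 2)} (λ _ → v)) ≡ v + k * v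
                     × altSum false (tabulate {n = suc (k * 2)} (λ _ → v)) ≡ k * v
altSum-const zero v = refl , refl
altSum-const (suc k) v = cong (v +_) (proj₁ (altSum-const k v)) , cong (v +_) (proj₂ (altSum-const k v))

sumBelow : ℕ → (ℕ → ℕ) → ℕ
sumBelow zero f = 0
sumBelow (suc K) f = sumBelow K f + f K

syntax sumBelow K (λ c → e) = ∑[ c < K ] e

sum-congBelow : ∀ K {f g : ℕ → ℕ} → (∀ {c} → c < K → f c ≡ g c) → sumBelow K f ≡ sumBelow K g
sum-congBelow zero f≈g = refl
sum-congBelow (suc K) f≈g = cong₂ _+_ (sum-congBelow K (f≈g ∘ m<n⇒m<1+n)) (f≈g (n<1+n K))

sum-mono-≤ : ∀ K {f g : ℕ → ℕ} → (∀ c → f c ≤ g c) → sumBelow K f ≤ sumBelow K g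
sum-mono-≤ zero f≤g = z≤n
sum-mono-≤ (suc K) f≤g = +-mono-≤ (sum-mono-≤ K f≤g) (f≤g K)

sum-+ : ∀ K (f g : ℕ → ℕ) → ∑[ c < K ] (f c + g c) ≡ sumBelow K f + sumBelow K g
sum-+ zero f g = refl
sum-+ (suc K) f g = trans (cong (_+ (f K + g K)) (sum-+ K f g)) (interchange (sumBelow K f) (sumBelow K g) (f K) (g K))

sum-zero : ∀ K → ∑[ c < K ] 0 ≡ 0
sum-zero zero = refl
sum-zero (suc K) = trans (+-identityʳ _) (sum-zero K)

[_↦_] : ℕ → ℕ → ℕ → ℕ
[ x ↦ v ] c = if does (c ≟ x) then v else 0

[↦]-same : ∀ x v → [ x ↦ v ] x ≡ v
[↦]-same x v = cong (if_then v else 0) (dec-true (x ≟ x) refl)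

[↦]-other : ∀ {x c} v → c ≢ x → [ x ↦ v ] c ≡ 0
[↦]-other {x} {c} v c≢x = cong (if_then v else 0) (dec-false (c ≟ x) c≢x)

sum-single : ∀ K {x v} → x < K → ∑[ c < K ] [ x ↦ v ] c ≡ v
sum-single (suc K) {x} {v} x<1+K with m<1+n⇒m<n∨m≡n x<1+K
... | inj₁ x<K = trans (cong₂ _+_ (sum-single K x<K) ([↦]-other v (<⇒≢ x<K ∘ sym))) (+-identityʳ v)
... | inj₂ refl = cong₂ _+_
  (trans (sum-congBelow K (λ c<x → [↦]-other v (<⇒≢ c<x))) (sum-zero K)) ([↦]-same x v)

term≤sum : ∀ K (f : ℕ → ℕ) {x} → x < K → f x ≤ sumBelow K f
term≤sum (suc K) f {x} x<1+K with m<1+n⇒m<n∨m≡n x<1+K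
... | inj₁ x<K = ≤-trans (term≤sum K f x<K) (m≤m+n _ _)
... | inj₂ refl = m≤n+m _ _

two-terms≤sum : ∀ K (f : ℕ → ℕ) {x y} → x < K → y < K → x ≢ y → f x + f y ≤ sumBelow K f
two-terms≤sum (suc K) f {x} {y} x<1+K y<1+K x≢y
  with m<1+n⇒m<n∨m≡n x<1+K | m<1+n⇒m<n∨m≡n y<1+K
... | inj₁ x<K | inj₁ y<K = ≤-trans (two-terms≤sum K f x<K y<K x≢y) (m≤m+n _ _)
... | inj₁ x<K | inj₂ refl = +-monoˡ-≤ (f y) (term≤sum K f x<K)
... | inj₂ refl | inj₁ y<K = ≤-trans (≤-reflexive (+-comm (f x) (f y))) (+-monoˡ-≤ (f x) (term≤sum K f y<K))
... | inj₂ refl | inj₂ refl = contradiction refl x≢y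

sum-altSum : ∀ K {n} t (f : ℕ → Fin n → ℕ) →
  ∑[ c < K ] altSum t (tabulate (f c)) ≡ altSum t (tabulate (λ i → ∑[ c < K ] f c i))
sum-altSum K {zero} t f = sum-zero K
sum-altSum K {suc n} true f =
  trans (sum-+ K _ _) (cong (sumBelow K (λ c → f c fzero) +_) (sum-altSum K false (λ c → f c ∘ fsuc)))
sum-altSum K {suc n} false f = sum-altSum K true (λ c → f c ∘ fsuc)

BoundedSet : ℕ → Colours → Set
BoundedSet K A = Unique A × All (_< K) A

does-⇔ : ∀ {P Q : Set} (P? : Dec P) (Q? : Dec Q) → (P → Q) → (Q → P) → does P? ≡ does Q?
does-⇔ (yes p) Q? to from = sym (dec-true Q? (to p))
does-⇔ (no ¬p) Q? to from = sym (dec-false Q? (¬p ∘ from))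

does-∧-not : ∀ {P Q R : Set} (P? : Dec P) (Q? : Dec Q) (R? : Dec R) →
  (R → P × ¬ Q) → (P → ¬ Q → R) → does R? ≡ does P? ∧ not (does Q?)
does-∧-not (yes p) (yes q) R? to from = dec-false R? (λ r → proj₂ (to r) q)
does-∧-not (yes p) (no ¬q) R? to from = dec-true R? (from p ¬q)
does-∧-not (no ¬p) Q? R? to from = dec-false R? (¬p ∘ proj₁ ∘ to)

𝟙-mem-∷ : ∀ c {x xs} → x ∉ xs → 𝟙 (mem c (x ∷ xs)) ≡ [ x ↦ 1 ] c + 𝟙 (mem c xs)
𝟙-mem-∷ c {x} {xs} x∉xs with c ≟ x
... | yes refl = trans (cong 𝟙 (dec-true (c ∈? c ∷ xs) (here refl)))
  (sym (cong₂ (λ u b → u + 𝟙 b) ([↦]-same c 1) (dec-false (c ∈? xs) x∉xs)))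
... | no c≢x = trans (cong 𝟙 (does-⇔ (c ∈? x ∷ xs) (c ∈? xs) drop-x there))
  (sym (cong (_+ 𝟙 (mem c xs)) ([↦]-other 1 c≢x)))
  where
  drop-x : c ∈ x ∷ xs → c ∈ xs
  drop-x (here c≡x) = contradiction c≡x c≢x
  drop-x (there c∈xs) = c∈xs

length-as-sum : ∀ K {A} → BoundedSet K A → length A ≡ ∑[ c < K ] 𝟙 (mem c A)
length-as-sum K {[]} _ = sym (sum-zero K)
length-as-sum K {x ∷ xs} (x∉xs ∷ distinct , x<K ∷ bounded) = sym (begin
  ∑[ c < K ] 𝟙 (mem c (x ∷ xs))                   ≡⟨ sum-congBelow K (λ {c} _ → 𝟙-mem-∷ c (All.All¬⇒¬Any x∉xs)) ⟩
  ∑[ c < K ] ([ x ↦ 1 ] c + 𝟙 (mem c xs))           ≡⟨ sum-+ K _ _ ⟩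
  ∑[ c < K ] [ x ↦ 1 ] c + ∑[ c < K ] 𝟙 (mem c xs) ≡⟨ cong₂ _+_ (sum-single K x<K) (sym (length-as-sum K (distinct , bounded))) ⟩
  suc (length xs)                                  ∎)
  where open ≡-Reasoning

mem-∖ : ∀ c A B → mem c (A ∖ B) ≡ mem c A ∧ not (mem c B)
mem-∖ c A B = does-∧-not (c ∈? A) (c ∈? B) (c ∈? A ∖ B) (∈-filter⁻ P?) (∈-filter⁺ P?)
  where
  P? : ∀ x → Dec (x ∉ B)
  P? x = ¬? (x ∈? B)

mem-∖-∉ : ∀ {c} A {B} → c ∉ B → mem c (A ∖ B) ≡ mem c A
mem-∖-∉ {c} A {B} c∉B =
  trans (mem-∖ c A B) (trans (cong (λ b → mem c A ∧ not b) (dec-false (c ∈? B) c∉B)) (∧-identityʳ _))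

∖-boundedSet : ∀ {K A} B → BoundedSet K A → BoundedSet K (A ∖ B)
∖-boundedSet B (distinct , bounded) =
  Unique.filter⁺ (λ x → ¬? (x ∈? B)) distinct , All.filter⁺ (λ x → ¬? (x ∈? B)) bounded

∖-identityʳ : ∀ A → A ∖ [] ≡ A
∖-identityʳ [] = refl
∖-identityʳ (x ∷ xs) = cong (x ∷_) (∖-identityʳ xs)

S-from-as-sum : ∀ K prev Ls → All (BoundedSet K) Ls →
  S-from prev Ls ≡ ∑[ c < K ] countX (mem c prev) (map (mem c) Ls)
S-from-as-sum K prev [] [] = sym (sum-zero K)
S-from-as-sum K prev (B ∷ Ls) (bounded ∷ bounded-Ls) = begin
  length (B ∖ prev) + S-from (B ∖ prev) Ls
    ≡⟨ cong₂ _+_ (length-as-sum K (∖-boundedSet prev bounded)) (S-from-as-sum K (B ∖ prev) Ls bounded-Ls) ⟩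
  ∑[ c < K ] 𝟙 (mem c (B ∖ prev)) + ∑[ c < K ] countX (mem c (B ∖ prev)) (map (mem c) Ls)
    ≡⟨ sym (sum-+ K _ _) ⟩
  ∑[ c < K ] (𝟙 (mem c (B ∖ prev)) + countX (mem c (B ∖ prev)) (map (mem c) Ls))
    ≡⟨ sum-congBelow K (λ {c} _ → trans (cong (λ b → 𝟙 b + countX b (map (mem c) Ls)) (mem-∖ c B prev))
                                         (sym (countX-∷ (mem c prev) (mem c B) _))) ⟩
  ∑[ c < K ] countX (mem c prev) (map (mem c) (B ∷ Ls)) ∎
  where open ≡-Reasoning

S-as-sum : ∀ {n} (L : ListAssignment n) K → (∀ i → BoundedSet K (L i)) →
  S n L ≡ ∑[ c < K ] countX false (tabulate (λ i → mem c (L i)))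
S-as-sum L K bounded = begin
  S-list (tabulate L)
    ≡⟨ S-list-from (tabulate L) ⟩
  S-from [] (tabulate L)
    ≡⟨ S-from-as-sum K [] (tabulate L) (All.tabulate⁺ bounded) ⟩
  ∑[ c < K ] countX false (map (mem c) (tabulate L))
    ≡⟨ sum-congBelow K (λ {c} _ → cong (countX false) (map-tabulate L (mem c))) ⟩
  ∑[ c < K ] countX false (tabulate (λ i → mem c (L i))) ∎
  where
  open ≡-Reasoning
  S-list-from : ∀ Ls → S-list Ls ≡ S-from [] Ls
  S-list-from [] = refl
  S-list-from (A ∷ Ls) rewrite ∖-identityʳ A = refl

delFirst-ignores : ∀ {n} (i : Fin n) p A → toℕ i ≢ 0 → delFirst i p A ≡ A
delFirst-ignores i p A i≢0 with toℕ i ≟ 0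
... | yes i≡0 = contradiction i≡0 i≢0
... | no _ = refl

delLast-ignores : ∀ n (i : Fin n) q A → suc (toℕ i) ≢ n → delLast n i q A ≡ A
delLast-ignores n i q A i≢last with suc (toℕ i) ≟ n
... | yes i≡last = contradiction i≡last i≢last
... | no _ = refl

delFirst-mem : ∀ {n c} (i : Fin n) {p} A → c ∉ p → mem c (delFirst i p A) ≡ mem c A
delFirst-mem i A c∉p with toℕ i ≟ 0
... | yes _ = mem-∖-∉ A c∉p
... | no _ = refl

delLast-mem : ∀ n {c} (i : Fin n) {q} A → c ∉ q → mem c (delLast n i q A) ≡ mem c A
delLast-mem n i A c∉q with suc (toℕ i) ≟ n
... | yes _ = mem-∖-∉ A c∉q
... | no _ = refl

delFirst-boundedSet : ∀ {n K} (i : Fin n) p {A} → BoundedSet K A → BoundedSet K (delFirst i p A)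
delFirst-boundedSet i p bounded with toℕ i ≟ 0
... | yes _ = ∖-boundedSet p bounded
... | no _ = bounded

delLast-boundedSet : ∀ n {K} (i : Fin n) q {A} → BoundedSet K A → BoundedSet K (delLast n i q A)
delLast-boundedSet n i q bounded with suc (toℕ i) ≟ n
... | yes _ = ∖-boundedSet q bounded
... | no _ = bounded

minus-cancelˡ-< : ∀ s m s′ → ℤ.+ s ℤ.- ℤ.+ m ℤ.< ℤ.+ s ℤ.- ℤ.+ s′ → s′ < m
minus-cancelˡ-< s m s′ lt with s′ <? m
... | yes s′<m = s′<m
... | no s′≮m =
  contradiction (ℤₚ.+-monoʳ-≤ (ℤ.+ s) (ℤₚ.neg-mono-≤ (ℤ.+≤+ (≮⇒≥ s′≮m)))) (ℤₚ.<⇒≱ lt)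

twice-odd : ∀ k → 2 * suc (k * 2) ≡ 2 + k * 4
twice-odd = solve-∀

∸2-split : ∀ t → t ≡ (t ∸ 2) + 2 ⊓ t
∸2-split t = sym (trans (+-comm (t ∸ 2) (2 ⊓ t)) (m⊓n+n∸m≡n 2 t))

+∸2≤ : ∀ e t x → e ≤ x → e + t ≤ 2 + x → e + (t ∸ 2) ≤ x
+∸2≤ e zero x e≤x _ = subst (_≤ x) (sym (+-identityʳ e)) e≤x
+∸2≤ e (suc zero) x e≤x _ = subst (_≤ x) (sym (+-identityʳ e)) e≤x
+∸2≤ e (suc (suc t)) x _ e+t≤2+x =
  +-cancelˡ-≤ 2 _ _ (subst (_≤ 2 + x) (trans (+-suc e (suc t)) (cong suc (+-suc e t))) e+t≤2+x)

two-mins≥3 : ∀ s t → 3 ≤ 2 ⊓ s + 2 ⊓ t → 1 ≤ s × 1 ≤ t × (2 ≤ s ⊎ 2 ≤ t)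
two-mins≥3 zero zero ()
two-mins≥3 zero (suc zero) (s≤s ())
two-mins≥3 zero (suc (suc t)) (s≤s (s≤s ()))
two-mins≥3 (suc zero) zero (s≤s ())
two-mins≥3 (suc zero) (suc zero) (s≤s (s≤s ()))
two-mins≥3 (suc zero) (suc (suc t)) _ = s≤s z≤n , s≤s z≤n , inj₂ (s≤s (s≤s z≤n))
two-mins≥3 (suc (suc s)) zero (s≤s (s≤s ()))
two-mins≥3 (suc (suc s)) (suc t) _ = s≤s z≤n , s≤s z≤n , inj₁ (s≤s (s≤s z≤n))

record Concentrated (w : ℕ → ℕ) (p : List ℕ) : Set where
  field
    positive : ∀ {x} → x ∈ p → 1 ≤ w x
    heavy : ∃[ h ] h ∈ p × 2 ≤ w h
    light-outside : ∀ {x} → x ∉ p → w x ≤ 1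
    sparse-outside : ∀ {x y} → x ∉ p → y ∉ p → x ≢ y → w x + w y ≤ 1

heavy∈ : ∀ {w p h} → Concentrated w p → 2 ≤ w h → h ∈ p
heavy∈ {p = p} {h} C 2≤wh with h ∈? p
... | yes h∈p = h∈p
... | no h∉p = ⊥-elim (1+n≰n (≤-trans 2≤wh (Concentrated.light-outside C h∉p)))

partner : ∀ {h a b} → h ∈ a ∷ b ∷ [] → ℕ
partner {b = b} (here _) = b
partner {a = a} (there _) = a

partner-∈ : ∀ {h a b} (e : h ∈ a ∷ b ∷ []) → partner e ∈ a ∷ b ∷ []
partner-∈ (here _) = there (here refl)
partner-∈ (there _) = here refl

partner-≢ : ∀ {h a b} → a < b → (e : h ∈ a ∷ b ∷ []) → partner e ≢ h
partner-≢ a<b (here refl) b≡a = <⇒≢ a<b (sym b≡a)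
partner-≢ a<b (there (here refl)) a≡b = <⇒≢ a<b a≡b

∈-pair : ∀ {h x a b} (e : h ∈ a ∷ b ∷ []) → x ∈ a ∷ b ∷ [] → x ≡ h ⊎ x ≡ partner e
∈-pair (here refl) (here refl) = inj₁ refl
∈-pair (here refl) (there (here refl)) = inj₂ refl
∈-pair (there (here refl)) (here refl) = inj₂ refl
∈-pair (there (here refl)) (there (here refl)) = inj₁ refl

partner-injective : ∀ {h a b c d} → a < b → c < d → (e₁ : h ∈ a ∷ b ∷ []) (e₂ : h ∈ c ∷ d ∷ []) →
  partner e₁ ≡ partner e₂ → (a , b) ≡ (c , d)
partner-injective a<b c<d (here refl) (here refl) b≡d = cong (_ ,_) b≡d
partner-injective a<b c<d (here refl) (there (here refl)) b≡c = ⊥-elim (<-asym a<b (subst (_< _) (sym b≡c) c<d))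
partner-injective a<b c<d (there (here refl)) (here refl) a≡d = ⊥-elim (<-asym a<b (subst (_ <_) (sym a≡d) c<d))
partner-injective a<b c<d (there (here refl)) (there (here refl)) a≡c = cong (_, _) a≡c

partner-∉ : ∀ {h a b c d} → a < b → c < d → (a , b) ≢ (c , d) →
  (e₁ : h ∈ a ∷ b ∷ []) (e₂ : h ∈ c ∷ d ∷ []) → partner e₂ ∉ a ∷ b ∷ []
partner-∉ a<b c<d p≢q e₁ e₂ y∈p with ∈-pair e₁ y∈p
... | inj₁ y≡h = partner-≢ c<d e₂ y≡h
... | inj₂ y≡y₁ = p≢q (partner-injective a<b c<d e₁ e₂ (sym y≡y₁))

no-three-concentrated : ∀ {w a₁ b₁ a₂ b₂ a₃ b₃} → a₁ < b₁ → a₂ < b₂ → a₃ < b₃ →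
  (a₁ , b₁) ≢ (a₂ , b₂) → (a₁ , b₁) ≢ (a₃ , b₃) → (a₂ , b₂) ≢ (a₃ , b₃) →
  Concentrated w (a₁ ∷ b₁ ∷ []) → Concentrated w (a₂ ∷ b₂ ∷ []) → Concentrated w (a₃ ∷ b₃ ∷ []) → ⊥
no-three-concentrated {a₂ = a₂} {b₂} {a₃} {b₃} a₁<b₁ a₂<b₂ a₃<b₃ p₁≢p₂ p₁≢p₃ p₂≢p₃ C₁ C₂ C₃ with Concentrated.heavy C₁
... | h , h∈p₁ , 2≤wh = 1+n≰n (≤-trans
  (+-mono-≤ (Concentrated.positive C₂ (partner-∈ h∈p₂)) (Concentrated.positive C₃ (partner-∈ h∈p₃)))
  (Concentrated.sparse-outside C₁ (partner-∉ a₁<b₁ a₂<b₂ p₁≢p₂ h∈p₁ h∈p₂) (partner-∉ a₁<b₁ a₃<b₃ p₁≢p₃ h∈p₁ h∈p₃)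
    (p₂≢p₃ ∘ partner-injective a₂<b₂ a₃<b₃ h∈p₂ h∈p₃)))
  where
  h∈p₂ : h ∈ a₂ ∷ b₂ ∷ []
  h∈p₂ = heavy∈ C₂ 2≤wh
  h∈p₃ : h ∈ a₃ ∷ b₃ ∷ []
  h∈p₃ = heavy∈ C₃ 2≤wh

at-most-two-concentrated : ∀ {w} (ps : List (ℕ × ℕ)) → Unique ps →
  All (λ { (a , b) → a < b × Concentrated w (a ∷ b ∷ []) }) ps → length ps ≤ 2
at-most-two-concentrated [] _ _ = z≤n
at-most-two-concentrated (_ ∷ []) _ _ = s≤s z≤n
at-most-two-concentrated (_ ∷ _ ∷ []) _ _ = s≤s (s≤s z≤n)
at-most-two-concentrated (_ ∷ _ ∷ _ ∷ _) ((p₁≢p₂ ∷ p₁≢p₃ ∷ _) ∷ (p₂≢p₃ ∷ _) ∷ _)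
  ((a₁<b₁ , C₁) ∷ (a₂<b₂ , C₂) ∷ (a₃<b₃ , C₃) ∷ _) =
  ⊥-elim (no-three-concentrated a₁<b₁ a₂<b₂ a₃<b₃ p₁≢p₂ p₁≢p₃ p₂≢p₃ C₁ C₂ C₃)

module OddPath (k : ℕ) (L : ListAssignment (suc (k * 2)))
  (lists : ∀ i → Unique (L i) × length (L i) ≡ 4) where

  n : ℕ
  n = suc (k * 2)

  inL : ℕ → Fin n → Bool
  inL c i = mem c (L i)

  -- Offset i stands for the vertex v_{i+1}: O counts the lists at v₁, v₃, …, v_n containing c,
  -- and E those at v₂, v₄, …, v_{n-1}.
  N O E excess : ℕ → ℕ
  N c = countX false (tabulate (inL c))
  O c = altSum true (tabulate (𝟙 ∘ inL c))
  E c = altSum false (tabulate (𝟙 ∘ inL c))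
  excess c = N c ∸ E c

  N′ : Colours → ℕ → ℕ
  N′ p c = countX false (tabulate (λ i → mem c (modify n L p p i)))

  altSum≤N : ∀ t c → altSum t (tabulate (𝟙 ∘ inL c)) ≤ N c
  altSum≤N t c = subst (_≤ N c) (cong (altSum t) (map-tabulate (inL c) 𝟙)) (altSum≤countX t (tabulate (inL c)))

  E≤N′ : ∀ p c → E c ≤ N′ p c
  E≤N′ p c = begin
    E c
      ≡⟨ altSum-agree false _ _ (λ i odd → cong (𝟙 ∘ mem c) (sym (interior i odd))) ⟩
    altSum false (tabulate (λ i → 𝟙 (mem c (modify n L p p i))))
      ≡⟨ cong (altSum false) (map-tabulate (λ i → mem c (modify n L p p i)) 𝟙) ⟨
    altSum false (map 𝟙 (tabulate (λ i → mem c (modify n L p p i))))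
      ≤⟨ altSum≤countX false (tabulate (λ i → mem c (modify n L p p i))) ⟩
    N′ p c ∎
    where
    open ≤-Reasoning
    interior : ∀ i → Counted false (toℕ i) → modify n L p p i ≡ L i
    interior i odd = trans
      (delLast-ignores n i p _ (λ i≡last → even-not-counted k (subst (Counted false) (suc-injective i≡last) odd)))
      (delFirst-ignores i p (L i) (λ i≡0 → subst (Counted false) i≡0 odd))

  N≤2+N′ : ∀ p c → N c ≤ 2 + N′ p c
  N≤2+N′ p c = ≤-trans
    (countX-agreeExcept 0 (inL c) first (λ i i≢0 → cong (mem c) (sym (delFirst-ignores i p (L i) i≢0))) false)
    (s≤s (countX-agreeExcept (k * 2) first (λ i → mem c (modify n L p p i))
      (λ i i≢last → cong (mem c) (sym (delLast-ignores n i p _ (i≢last ∘ suc-injective)))) false))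
    where
    first : Fin n → Bool
    first i = mem c (delFirst i p (L i))

  N′≡N : ∀ {p c} → c ∉ p → N′ p c ≡ N c
  N′≡N {p} {c} c∉p = cong (countX false) (tabulate-cong (λ i →
    trans (delLast-mem n i (delFirst i p (L i)) c∉p) (delFirst-mem i (L i) c∉p)))

  -- Any range containing all colours of L computes S; letting it exceed an arbitrary m is what
  -- makes the sum estimates below reach every colour.
  bound : ℕ → ℕ
  bound m = suc (m ⊔ max 0 (concat (tabulate L)))

  <-bound : ∀ {x m} → x ≤ m → x < bound m
  <-bound x≤m = s≤s (≤-trans x≤m (m≤m⊔n _ _))

  bounded : ∀ m i → BoundedSet (bound m) (L i)
  bounded m i = proj₁ (lists i) , All.tabulate (λ c∈Li →
    s≤s (≤-trans (All.lookup (xs≤max 0 (concat (tabulate L))) (∈-concat⁺′ c∈Li (∈-tabulate⁺ {f = L} i))) (m≤n⊔m m _)))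

  sum-parity : ∀ m t → ∑[ c < bound m ] altSum t (tabulate (𝟙 ∘ inL c)) ≡ altSum t (tabulate {n = n} (λ _ → 4))
  sum-parity m t = trans (sum-altSum (bound m) t (λ c → 𝟙 ∘ inL c)) (cong (altSum t) (tabulate-cong (λ i →
    trans (sym (length-as-sum (bound m) (bounded m i))) (proj₂ (lists i)))))

  sum-O : ∀ m → ∑[ c < bound m ] O c ≡ 4 + k * 4
  sum-O m = trans (sum-parity m true) (proj₁ (altSum-const k 4))

  sum-E : ∀ m → ∑[ c < bound m ] E c ≡ k * 4
  sum-E m = trans (sum-parity m false) (proj₂ (altSum-const k 4))

  sum-excess≥4 : ∀ m → 4 ≤ ∑[ c < bound m ] excess c
  sum-excess≥4 m = +-cancelˡ-≤ (k * 4) 4 _ (begin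
    k * 4 + 4                                             ≡⟨ +-comm (k * 4) 4 ⟩
    4 + k * 4                                             ≡⟨ sum-O m ⟨
    ∑[ c < bound m ] O c                                  ≤⟨ sum-mono-≤ (bound m) (altSum≤N true) ⟩
    ∑[ c < bound m ] N c                                  ≡⟨ sum-congBelow (bound m) (λ {c} _ → m+[n∸m]≡n (altSum≤N false c)) ⟨
    ∑[ c < bound m ] (E c + excess c)                     ≡⟨ sum-+ (bound m) E excess ⟩
    ∑[ c < bound m ] E c + ∑[ c < bound m ] excess c      ≡⟨ cong (_+ ∑[ c < bound m ] excess c) (sum-E m) ⟩
    k * 4 + ∑[ c < bound m ] excess c                     ∎)
    where open ≤-Reasoning

  bad⇒sum-N′< : ∀ m {a b} → IsBadPair n L a b → ∑[ c < bound m ] N′ (a ∷ b ∷ []) c < 2 + k * 4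
  bad⇒sum-N′< m {a} {b} bad = subst₂ _<_
    (S-as-sum (modify n L p p) (bound m) (λ i →
      delLast-boundedSet n i p (delFirst-boundedSet i p (bounded m i))))
    (twice-odd k)
    (minus-cancelˡ-< (S n L) (2 * n) (S n (modify n L p p)) bad)
    where
    p : Colours
    p = a ∷ b ∷ []

  module BadPair {a b : ℕ} (a<b : a < b) (bad : IsBadPair n L a b) where

    p : Colours
    p = a ∷ b ∷ []

    residual : ℕ → ℕ
    residual c = if mem c p then excess c ∸ 2 else excess c

    residual-inside : ∀ {c} → c ∈ p → residual c ≡ excess c ∸ 2
    residual-inside {c} c∈p = cong (if_then excess c ∸ 2 else excess c) (dec-true (c ∈? p) c∈p)

    residual-outside : ∀ {c} → c ∉ p → residual c ≡ excess c
    residual-outside {c} c∉p = cong (if_then excess c ∸ 2 else excess c) (dec-false (c ∈? p) c∉p)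

    E+residual≤N′ : ∀ c → E c + residual c ≤ N′ p c
    E+residual≤N′ c with c ∈? p
    ... | yes c∈p = subst (λ r → E c + r ≤ N′ p c) (sym (residual-inside c∈p))
      (+∸2≤ (E c) (excess c) (N′ p c) (E≤N′ p c)
        (subst (_≤ 2 + N′ p c) (sym (m+[n∸m]≡n (altSum≤N false c))) (N≤2+N′ p c)))
    ... | no c∉p = ≤-reflexive (begin
      E c + residual c ≡⟨ cong (E c +_) (residual-outside c∉p) ⟩
      E c + excess c   ≡⟨ m+[n∸m]≡n (altSum≤N false c) ⟩
      N c              ≡⟨ N′≡N c∉p ⟨
      N′ p c           ∎)
      where open ≡-Reasoning

    sum-residual≤1 : ∀ m → ∑[ c < bound m ] residual c ≤ 1
    sum-residual≤1 m = ≤-pred (+-cancelˡ-< (k * 4) _ 2 (begin-strict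
      k * 4 + ∑[ c < bound m ] residual c                ≡⟨ cong (_+ ∑[ c < bound m ] residual c) (sum-E m) ⟨
      ∑[ c < bound m ] E c + ∑[ c < bound m ] residual c ≡⟨ sum-+ (bound m) E residual ⟨
      ∑[ c < bound m ] (E c + residual c)                ≤⟨ sum-mono-≤ (bound m) E+residual≤N′ ⟩
      ∑[ c < bound m ] N′ p c                            <⟨ bad⇒sum-N′< m bad ⟩
      2 + k * 4                                          ≡⟨ +-comm 2 (k * 4) ⟩
      k * 4 + 2                                          ∎))
      where open ≤-Reasoning

    excess-split : ∀ c → excess c ≡ residual c + [ a ↦ 2 ⊓ excess a ] c + [ b ↦ 2 ⊓ excess b ] c
    excess-split c with c ≟ a | c ≟ b
    ... | yes refl | _ rewrite residual-inside (here refl) | [↦]-same c (2 ⊓ excess c)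
                             | [↦]-other (2 ⊓ excess b) (<⇒≢ a<b) = trans (∸2-split (excess c)) (sym (+-identityʳ _))
    ... | no c≢a | yes refl rewrite residual-inside (there (here refl)) | [↦]-other (2 ⊓ excess a) c≢a
                             | [↦]-same c (2 ⊓ excess c) = trans (∸2-split (excess c)) (cong (_+ 2 ⊓ excess c) (sym (+-identityʳ _)))
    ... | no c≢a | no c≢b rewrite residual-outside {c} (λ { (here c≡a) → c≢a c≡a ; (there (here c≡b)) → c≢b c≡b })
                             | [↦]-other (2 ⊓ excess a) c≢a | [↦]-other (2 ⊓ excess b) c≢b = sym (trans (+-identityʳ _) (+-identityʳ _))

    pair-mass≥3 : 3 ≤ 2 ⊓ excess a + 2 ⊓ excess b
    pair-mass≥3 = +-cancelˡ-≤ 1 3 _ (begin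
      4                                                         ≤⟨ sum-excess≥4 m ⟩
      ∑[ c < bound m ] excess c                                 ≡⟨ sum-congBelow (bound m) (λ {c} _ → excess-split c) ⟩
      ∑[ c < bound m ] (residual c + [ a ↦ 2 ⊓ excess a ] c + [ b ↦ 2 ⊓ excess b ] c)
                                                                ≡⟨ trans (sum-+ (bound m) _ _) (cong₂ _+_ (sum-+ (bound m) _ _) (sum-single (bound m) (<-bound (m≤n⊔m a b)))) ⟩
      ∑[ c < bound m ] residual c + ∑[ c < bound m ] [ a ↦ 2 ⊓ excess a ] c + 2 ⊓ excess b
                                                                ≡⟨ cong (λ s → ∑[ c < bound m ] residual c + s + 2 ⊓ excess b) (sum-single (bound m) (<-bound (m≤m⊔n a b))) ⟩
      ∑[ c < bound m ] residual c + 2 ⊓ excess a + 2 ⊓ excess b ≤⟨ +-monoˡ-≤ _ (+-monoˡ-≤ _ (sum-residual≤1 m)) ⟩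
      1 + 2 ⊓ excess a + 2 ⊓ excess b                           ≡⟨ +-assoc 1 (2 ⊓ excess a) (2 ⊓ excess b) ⟩
      1 + (2 ⊓ excess a + 2 ⊓ excess b)                         ∎)
      where
      m : ℕ
      m = a ⊔ b
      open ≤-Reasoning

    concentrated : Concentrated excess p
    concentrated = record
      { positive = λ { (here refl) → 1≤a ; (there (here refl)) → 1≤b }
      ; heavy = heavy
      ; light-outside = λ {x} x∉p → begin
          excess x                  ≡⟨ residual-outside x∉p ⟨
          residual x                ≤⟨ term≤sum (bound x) residual (<-bound ≤-refl) ⟩
          ∑[ c < bound x ] residual c ≤⟨ sum-residual≤1 x ⟩
          1                         ∎
      ; sparse-outside = λ {x} {y} x∉p y∉p x≢y → begin
          excess x + excess y       ≡⟨ cong₂ _+_ (residual-outside x∉p) (residual-outside y∉p) ⟨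
          residual x + residual y   ≤⟨ two-terms≤sum (bound (x ⊔ y)) residual (<-bound (m≤m⊔n x y)) (<-bound (m≤n⊔m x y)) x≢y ⟩
          ∑[ c < bound (x ⊔ y) ] residual c ≤⟨ sum-residual≤1 (x ⊔ y) ⟩
          1                         ∎
      }
      where
      open ≤-Reasoning
      1≤a : 1 ≤ excess a
      1≤a = proj₁ (two-mins≥3 _ _ pair-mass≥3)
      1≤b : 1 ≤ excess b
      1≤b = proj₁ (proj₂ (two-mins≥3 _ _ pair-mass≥3))
      heavy : ∃[ h ] h ∈ p × 2 ≤ excess h
      heavy with proj₂ (proj₂ (two-mins≥3 _ _ pair-mass≥3))
      ... | inj₁ 2≤a = a , here refl , 2≤a
      ... | inj₂ 2≤b = b , there (here refl) , 2≤b

odd⇒suc[half*2] : ∀ {n} → n % 2 ≡ 1 → n ≡ suc (n / 2 * 2)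
odd⇒suc[half*2] {n} n%2≡1 = trans (m≡m%n+[m/n]*n n 2) (cong (_+ n / 2 * 2) n%2≡1)

lemma5p2 : (n : ℕ) → n % 2 ≡ 1 →
    (L : ListAssignment n) →
    ((i : Fin n) → Unique (L i) × length (L i) ≡ 4) →
    (W : List ℕ) → Unique W → length W ≡ 4 →
    (bad : List (ℕ × ℕ)) → Unique bad →
    All (λ { (a , b) → a < b × a ∈ W × b ∈ W × IsBadPair n L a b }) bad →
    length bad ≤ 2
lemma5p2 n odd L lists _ _ _ bad distinct bad-sets with n / 2 | odd⇒suc[half*2] {n} odd
... | k | refl = at-most-two-concentrated bad distinct (All.map
  (λ { (a<b , _ , _ , isBad) → a<b , OddPath.BadPair.concentrated k L lists a<b isBad }) bad-sets)
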